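{- Let $P_n$ be the path graph on $n>2$ vertices. Then, for every $k\in\{0,1,\ldots,n\}$, $$W_{\rho_k}(P_n)=\binom{n+1}{k+1}\frac{5k^3n^2+k^3n+18k^2n^2-18k^2n-12k^2+19kn^2-25kn+12k+6n^2-6n}{6(k+2)(k+3)}.$$
   Context: $P_n$ has vertex set $\{1,\ldots,n\}$ and edges $\{i,i+1\}$. For a graph $G$, $A\subseteq V_G$ and $u,v\in V_G$, $\rho_A(u,v)$ is the minimum length of a walk in $G$ from $u$ to $v$ (vertex repetitions allowed, length $\ge0$) visiting every vertex of $A$ (so $\rho_\emptyset$ is the geodesic distance); $W_{\rho_A}(G)=\frac12\sum_{u,v\in V_G}\rho_A(u,v)$ over all ordered pairs including $u=v$; and $W_{\rho_k}(G)=\sum_{A\subseteq V_G,\ |A|=k}W_{\rho_A}(G)$. -}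

module Defs where

open import Data.Nat using (ℕ; zero; suc; _+_; _*_)
open import Data.Nat.Properties using (_≟_)
open import Data.Fin using (Fin; toℕ)
open import Data.Fin.Subset using (Subset; _∈_; ∣_∣)
open import Data.Vec using (Vec; []; _∷_; head; last; lookup)
open import Data.Vec.Relation.Unary.Linked using (Linked)
open import Data.List using (List; []; _∷_; map; allFin; concatMap; filter)
open import Data.Nat.ListAction using (sum)
open import Data.Bool using (true; false)
open import Data.Product using (Σ; _×_; ∃)
open import Data.Sum using (_⊎_)
open import Relation.Binary.PropositionalEquality using (_≡_)
open import Relation.Nullary using (¬_)
open import Level using (0ℓ)
open import Relation.Binary using (Rel)

Graph : ℕ → Set₁
Graph n = Rel (Fin n) 0ℓ

-- The path P_n: vertex i : Fin n stands for the vertex (toℕ i + 1);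
-- edges {i, i+1}.
P : (n : ℕ) → Graph n
P n i j = (suc (toℕ i) ≡ toℕ j) ⊎ (suc (toℕ j) ≡ toℕ i)

record Walk {n : ℕ} (G : Graph n) (A : Subset n) (u v : Fin n) (r : ℕ) : Set where
  field
    verts   : Vec (Fin n) (suc r)
    starts  : head verts ≡ u
    ends    : last verts ≡ v
    steps   : Linked G verts
    visits  : ∀ x → x ∈ A → ∃ λ (i : Fin (suc r)) → lookup verts i ≡ x

IsRho : {n : ℕ} → Graph n → Subset n → Fin n → Fin n → ℕ → Set
IsRho G A u v r = Walk G A u v r × (∀ s → Walk G A u v s → r Data.Nat.≤ s)

allSubsets : (n : ℕ) → List (Subset n)
allSubsets zero = [] ∷ []
allSubsets (suc n) = concatMap (λ s → (true ∷ s) ∷ (false ∷ s) ∷ []) (allSubsets n)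

subsetsOfSize : (n k : ℕ) → List (Subset n)
subsetsOfSize n k = filter (λ A → ∣ A ∣ ≟ k) (allSubsets n)

-- Σ_{u,v ∈ V} ρ(u,v) over ordered pairs (including u = v); this is 2·W_{ρ_A}.
pairSum : {n : ℕ} → (Fin n → Fin n → ℕ) → ℕ
pairSum {n} f = sum (map (λ u → sum (map (λ v → f u v) (allFin n))) (allFin n))

-- Σ_{|A| = k} Σ_{u,v} ρ_A(u,v) = 2 · W_{ρ_k}
twiceWρk : (n k : ℕ) → (Subset n → Fin n → Fin n → ℕ) → ℕ
twiceWρk n k ρ = sum (map (λ A → pairSum (ρ A)) (subsetsOfSize n k))

-- On the path 0 − 1 − ⋯ − (n − 1) let L ≤ R be the extreme vertices of A ∪ {u, v}. A walk from u to v through A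
-- reaches both L and R, so its length is at least 2(R − L) − |u − v|, and the tour u → L → R → v (or u → R → L → v)
-- attains this bound: ρ_A(u, v) + |u − v| + 2L = 2R. Writing L = #{x : x < L} and R = n − #{x : R ≤ x}, and noting
-- that R ≤ x iff A ∪ {u, v} ⊆ [0, x], the sum over all u, v and all k-subsets A becomes a sum over thresholds x of
-- (x + 1)² C(x + 1, k) and of its mirror image. With Σ_{a,b} |a − b| = (n³ − n)/3 and a closed form for
-- Σ_{m<n} m² C(m, k), what is left is polynomial arithmetic.

module Submission where

open import Defs

module Counting where

  open import Data.Bool.Base using (true; false; if_then_else_)
  open import Data.Fin.Base using (Fin; zero; suc; toℕ; fromℕ; fromℕ<; inject₁)
  open import Data.Fin.Permutation using (reverse)
  open import Data.Fin.Subset using (Subset; _∈_; _⊆_; ∣_∣)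
  open import Data.Fin.Subset.Properties using (_⊆?_; _∈?_)
  open import Data.Fin.Properties using (toℕ-inject₁; toℕ-fromℕ; toℕ-fromℕ<; toℕ-injective; opposite-prop; toℕ<n)
  open import Data.List.Base as List using (List; []; _∷_; map; filter; allFin)
  open import Data.List.Extrema.Nat
    using (argmin; argmax; argmin-all; argmax-all; f[argmin]≤f[⊤]; f[argmin]≤f[xs]; f[⊥]≤f[argmax]; f[xs]≤f[argmax])
  open import Data.List.Membership.Propositional.Properties using (∈-filter⁺; ∈-allFin)
  open import Data.List.Relation.Unary.All as All using (All; _∷_)
  open import Data.List.Relation.Unary.All.Properties using (all-filter)
  open import Data.Vec.Base as Vec using (Vec; []; _∷_; lookup; head; last)
  open import Data.Vec.Properties using (lookup∘tabulate; []=⇒lookup; lookup⇒[]=)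
  open import Data.Vec.Relation.Unary.Linked using (Linked; [-]; _∷_)
  open import Data.Sum.Base using (_⊎_; inj₁; inj₂)
  open import Data.Nat.Tactic.RingSolver using (solve-∀)
  open import Data.Nat.Base
  open import Data.Nat.Combinatorics using (_C_; nCk+nC[k+1]≡[n+1]C[k+1]; nC1≡n)
  open import Data.Nat.ListAction using (sum)
  open import Data.Nat.Properties
  open import Algebra.Properties.CommutativeSemigroup +-commutativeSemigroup
    using () renaming (interchange to +-interchange)
  open import Algebra.Properties.Semiring.Sum +-*-semiring
    using (sum-syntax; sum-cong-≗; sum-init-last; ∑-distrib-+; ∑-comm; ∑-permute; *-distribˡ-sum; *-distribʳ-sum)
  open import Data.Product.Base using (_×_; _,_; proj₁; proj₂; ∃)
  open import Function.Base using (_∘_; id)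
  open import Level using (0ℓ)
  open import Function.Bundles using (_⇔_; mk⇔; Equivalence)
  open import Relation.Binary.PropositionalEquality
  open import Relation.Nullary.Decidable using (Dec; yes; no; does; _×-dec_)
  open import Relation.Nullary.Negation using (¬_; contradiction)
  open import Relation.Unary using (Pred; Decidable)

  -- Indicators and finite sums

  ⟦_⟧ : {P : Set} → Dec P → ℕ
  ⟦ p? ⟧ = if does p? then 1 else 0

  ⟦⟧-cong : {P Q : Set} (p? : Dec P) (q? : Dec Q) → P ⇔ Q → ⟦ p? ⟧ ≡ ⟦ q? ⟧
  ⟦⟧-cong (yes _) (yes _) _   = refl
  ⟦⟧-cong (no _)  (no _)  _   = refl
  ⟦⟧-cong (yes p) (no ¬q) p⇔q = contradiction (Equivalence.to p⇔q p) ¬q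
  ⟦⟧-cong (no ¬p) (yes q) p⇔q = contradiction (Equivalence.from p⇔q q) ¬p

  ⟦×-dec⟧ : {P Q : Set} (p? : Dec P) (q? : Dec Q) → ⟦ p? ×-dec q? ⟧ ≡ ⟦ p? ⟧ * ⟦ q? ⟧
  ⟦×-dec⟧ (yes _) (yes _) = refl
  ⟦×-dec⟧ (yes _) (no _)  = refl
  ⟦×-dec⟧ (no _)  _       = refl

  ⟦⟧-complement : {P Q : Set} (p? : Dec P) (q? : Dec Q) → (P → ¬ Q) → (¬ P → Q) → ⟦ p? ⟧ + ⟦ q? ⟧ ≡ 1
  ⟦⟧-complement (yes p) (yes q) p⇒¬q _   = contradiction q (p⇒¬q p)
  ⟦⟧-complement (yes _) (no _)  _    _   = refl
  ⟦⟧-complement (no _)  (yes _) _    _   = refl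
  ⟦⟧-complement (no ¬p) (no ¬q) _   ¬p⇒q = contradiction (¬p⇒q ¬p) ¬q

  ⟦≤?⟧+⟦<?⟧ : ∀ m n → ⟦ m ≤? n ⟧ + ⟦ n <? m ⟧ ≡ 1
  ⟦≤?⟧+⟦<?⟧ m n = ⟦⟧-complement (m ≤? n) (n <? m) ≤⇒≯ ≰⇒>

  ∑-const : ∀ n c → ∑[ i < n ] c ≡ n * c
  ∑-const zero    c = refl
  ∑-const (suc n) c = cong (c +_) (∑-const n c)

  ∑-toℕ-last : ∀ n (g : ℕ → ℕ) → ∑[ i < suc n ] g (toℕ i) ≡ ∑[ i < n ] g (toℕ i) + g n
  ∑-toℕ-last n g = trans (sum-init-last {n} (g ∘ toℕ))
    (cong₂ _+_ (sum-cong-≗ {n} (cong g ∘ toℕ-inject₁)) (cong g (toℕ-fromℕ n)))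

  ∑-toℕ-reverse : ∀ n (g : ℕ → ℕ) → ∑[ i < n ] g (n ∸ suc (toℕ i)) ≡ ∑[ i < n ] g (toℕ i)
  ∑-toℕ-reverse n g = trans (sum-cong-≗ {n} (cong g ∘ sym ∘ opposite-prop)) (sym (∑-permute {n} (g ∘ toℕ) reverse))

  ∑-suc : ∀ n (f : Fin n → ℕ) → ∑[ i < n ] suc (f i) ≡ n + ∑[ i < n ] f i
  ∑-suc n f = trans (∑-distrib-+ {n} (λ _ → 1) f) (cong (_+ ∑[ i < n ] f i) (trans (∑-const n 1) (*-identityʳ n)))

  ∑-⟦<?⟧ : ∀ n t → ∑[ i < n ] ⟦ toℕ i <? t ⟧ ≡ n ⊓ t
  ∑-⟦<?⟧ zero    t = refl
  ∑-⟦<?⟧ (suc n) t =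
    trans (∑-toℕ-last n (λ y → ⟦ y <? t ⟧)) (trans (cong (_+ ⟦ n <? t ⟧) (∑-⟦<?⟧ n t)) (step (n <? t)))
    where
    step : (n<t : Dec (n < t)) → n ⊓ t + ⟦ n<t ⟧ ≡ suc n ⊓ t
    step (yes n<t) = trans (cong (_+ 1) (m≤n⇒m⊓n≡m (<⇒≤ n<t))) (trans (+-comm n 1) (sym (m≤n⇒m⊓n≡m n<t)))
    step (no n≮t)  = trans (+-identityʳ _) (trans (m≥n⇒m⊓n≡n t≤n) (sym (m≥n⇒m⊓n≡n (m≤n⇒m≤1+n t≤n))))
      where t≤n = ≮⇒≥ n≮t

  ∑-⟦≤?⟧ : ∀ n x → ∑[ i < n ] ⟦ toℕ i ≤? x ⟧ ≡ n ⊓ suc x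
  ∑-⟦≤?⟧ n x =
    trans (sum-cong-≗ {n} λ i → ⟦⟧-cong (toℕ i ≤? x) (toℕ i <? suc x) (mk⇔ s≤s s≤s⁻¹)) (∑-⟦<?⟧ n (suc x))

  ∑-⟦≥?⟧ : ∀ n t → ∑[ i < n ] ⟦ t ≤? toℕ i ⟧ + n ⊓ t ≡ n
  ∑-⟦≥?⟧ n t = begin
    ∑[ i < n ] ⟦ t ≤? toℕ i ⟧ + n ⊓ t
      ≡⟨ cong (∑[ i < n ] ⟦ t ≤? toℕ i ⟧ +_) (∑-⟦<?⟧ n t) ⟨
    ∑[ i < n ] ⟦ t ≤? toℕ i ⟧ + ∑[ i < n ] ⟦ toℕ i <? t ⟧
      ≡⟨ ∑-distrib-+ {n} _ _ ⟨
    ∑[ i < n ] (⟦ t ≤? toℕ i ⟧ + ⟦ toℕ i <? t ⟧)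
      ≡⟨ sum-cong-≗ {n} (λ i → ⟦≤?⟧+⟦<?⟧ t (toℕ i)) ⟩
    ∑[ i < n ] 1
      ≡⟨ trans (∑-const n 1) (*-identityʳ n) ⟩
    n ∎
    where open ≡-Reasoning

  count-≤ : ∀ {n} (i : Fin n) → ∑[ u < n ] ⟦ toℕ u ≤? toℕ i ⟧ ≡ suc (toℕ i)
  count-≤ {n} i = trans (∑-⟦≤?⟧ n (toℕ i)) (m≥n⇒m⊓n≡n (toℕ<n i))

  count-< : ∀ {n} (i : Fin n) → ∑[ u < n ] ⟦ toℕ i <? toℕ u ⟧ ≡ n ∸ suc (toℕ i)
  count-< {n} i = trans (sym (m+n∸n≡m _ (suc (toℕ i)))) (cong (_∸ suc (toℕ i)) (trans
    (cong (∑[ u < n ] ⟦ toℕ i <? toℕ u ⟧ +_) (sym (m≥n⇒m⊓n≡n (toℕ<n i)))) (∑-⟦≥?⟧ n (suc (toℕ i)))))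

  module _ {n : ℕ} where

    ∑²-distrib-+ : (f g : Fin n → Fin n → ℕ) →
                   ∑[ u < n ] ∑[ v < n ] (f u v + g u v) ≡ ∑[ u < n ] ∑[ v < n ] f u v + ∑[ u < n ] ∑[ v < n ] g u v
    ∑²-distrib-+ f g = trans (sum-cong-≗ {n} λ u → ∑-distrib-+ {n} (f u) (g u)) (∑-distrib-+ {n} _ _)

    *-distribˡ-∑² : ∀ c (f : Fin n → Fin n → ℕ) →
                    c * (∑[ u < n ] ∑[ v < n ] f u v) ≡ ∑[ u < n ] ∑[ v < n ] (c * f u v)
    *-distribˡ-∑² c f = trans (*-distribˡ-sum {n} c _) (sum-cong-≗ {n} λ u → *-distribˡ-sum {n} c (f u))

    ∑²-comm-∑ : ∀ m (f : Fin n → Fin n → Fin m → ℕ) →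
                ∑[ u < n ] ∑[ v < n ] ∑[ i < m ] f u v i ≡ ∑[ i < m ] ∑[ u < n ] ∑[ v < n ] f u v i
    ∑²-comm-∑ m f = trans (sum-cong-≗ {n} λ u → ∑-comm {n} {m} (f u)) (∑-comm {n} {m} _)

    ∑²-product : ∀ (a b : Fin n → ℕ) c →
                 ∑[ u < n ] ∑[ v < n ] (a u * (b v * c)) ≡ (∑[ u < n ] a u) * ((∑[ v < n ] b v) * c)
    ∑²-product a b c = trans
      (sum-cong-≗ {n} λ u → trans (sym (*-distribˡ-sum {n} (a u) _)) (cong (a u *_) (sym (*-distribʳ-sum {n} c b))))
      (sym (*-distribʳ-sum {n} _ a))

  -- Sums over the k-subsets of Fin n

  module _ {A : Set} where

    sum-map-tabulate : ∀ n (g : Fin n → A) (f : A → ℕ) → sum (map f (List.tabulate g)) ≡ ∑[ i < n ] f (g i)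
    sum-map-tabulate zero    g f = refl
    sum-map-tabulate (suc n) g f = cong (f (g zero) +_) (sum-map-tabulate n (g ∘ suc) f)

    sum-map-filter : {P : Pred A 0ℓ} (P? : Decidable P) (h : A → ℕ) (xs : List A) →
                     sum (map h (filter P? xs)) ≡ sum (map (λ x → if does (P? x) then h x else 0) xs)
    sum-map-filter P? h []       = refl
    sum-map-filter P? h (x ∷ xs) with does (P? x)
    ... | true  = cong (h x +_) (sum-map-filter P? h xs)
    ... | false = sum-map-filter P? h xs

    sum-map-cong : (xs : List A) {f g : A → ℕ} → (∀ x → f x ≡ g x) → sum (map f xs) ≡ sum (map g xs)
    sum-map-cong []       f≗g = refl
    sum-map-cong (x ∷ xs) f≗g = cong₂ _+_ (f≗g x) (sum-map-cong xs f≗g)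

    sum-map-+ : (xs : List A) (f g : A → ℕ) → sum (map (λ x → f x + g x) xs) ≡ sum (map f xs) + sum (map g xs)
    sum-map-+ []       f g = refl
    sum-map-+ (x ∷ xs) f g = trans (cong (f x + g x +_) (sum-map-+ xs f g)) (+-interchange (f x) (g x) _ _)

    sum-map-*ˡ : (xs : List A) (c : ℕ) (f : A → ℕ) → sum (map (λ x → c * f x) xs) ≡ c * sum (map f xs)
    sum-map-*ˡ []       c f = sym (*-zeroʳ c)
    sum-map-*ˡ (x ∷ xs) c f = trans (cong (c * f x +_) (sum-map-*ˡ xs c f)) (sym (*-distribˡ-+ c (f x) _))

    sum-map-∑ : (xs : List A) (m : ℕ) (f : A → Fin m → ℕ) →
                sum (map (λ x → ∑[ i < m ] f x i) xs) ≡ ∑[ i < m ] sum (map (λ x → f x i) xs)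
    sum-map-∑ []       m f = sym (trans (∑-const m 0) (*-zeroʳ m))
    sum-map-∑ (x ∷ xs) m f = trans (cong (∑[ i < m ] f x i +_) (sum-map-∑ xs m f)) (sym (∑-distrib-+ (f x) _))

  module _ {n} {Q : Fin n → Set} (Q? : ∀ i → Dec (Q i)) where

    ∈-tabulate⁺ : ∀ {i} → Q i → i ∈ Vec.tabulate (λ j → does (Q? j))
    ∈-tabulate⁺ {i} q = lookup⇒[]= i _ (trans (lookup∘tabulate _ i) (does-yes (Q? i)))
      where
      does-yes : (q? : Dec (Q i)) → does q? ≡ true
      does-yes (yes _) = refl
      does-yes (no ¬q) = contradiction q ¬q

    ∈-tabulate⁻ : ∀ {i} → i ∈ Vec.tabulate (λ j → does (Q? j)) → Q i
    ∈-tabulate⁻ {i} i∈ with Q? i | trans (sym (lookup∘tabulate _ i)) ([]=⇒lookup i∈)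
    ... | yes q | _ = q
    ... | no _  | ()

  ∣tabulate∣ : ∀ {n} {Q : Fin n → Set} (Q? : ∀ i → Dec (Q i)) →
               ∣ Vec.tabulate (λ i → does (Q? i)) ∣ ≡ ∑[ i < n ] ⟦ Q? i ⟧
  ∣tabulate∣ {zero}  Q? = refl
  ∣tabulate∣ {suc n} Q? with does (Q? zero)
  ... | true  = cong suc (∣tabulate∣ (Q? ∘ suc))
  ... | false = ∣tabulate∣ (Q? ∘ suc)

  atMost : ∀ n → ℕ → Subset n
  atMost n x = Vec.tabulate (λ i → does (toℕ i ≤? x))

  above : ∀ n → ℕ → Subset n
  above n x = Vec.tabulate (λ i → does (x <? toℕ i))

  subsetSum : (n k : ℕ) → (Subset n → ℕ) → ℕ
  subsetSum n k h = sum (map h (subsetsOfSize n k))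

  sum-map-allSubsets-suc : ∀ n (f : Subset (suc n) → ℕ) →
    sum (map f (allSubsets (suc n))) ≡ sum (map (λ s → f (true ∷ s) + f (false ∷ s)) (allSubsets n))
  sum-map-allSubsets-suc n f = go (allSubsets n)
    where
    go : (xs : List (Subset n)) →
         sum (map f (List.concatMap (λ s → (true ∷ s) ∷ (false ∷ s) ∷ []) xs))
           ≡ sum (map (λ s → f (true ∷ s) + f (false ∷ s)) xs)
    go []       = refl
    go (s ∷ xs) = trans (cong (λ t → f (true ∷ s) + (f (false ∷ s) + t)) (go xs))
                        (sym (+-assoc (f (true ∷ s)) (f (false ∷ s)) _))

  subsetSum-suc : ∀ n k h →
    subsetSum (suc n) (suc k) h ≡ subsetSum n k (h ∘ (true ∷_)) + subsetSum n (suc k) (h ∘ (false ∷_))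
  subsetSum-suc n k h =
    trans (sum-map-filter _ h (allSubsets (suc n)))
    (trans (sum-map-allSubsets-suc n _)
    (trans (sum-map-+ (allSubsets n) _ _)
    (sym (cong₂ _+_ (sum-map-filter _ _ (allSubsets n)) (sum-map-filter _ _ (allSubsets n))))))

  subsetSum-zero : ∀ n h → subsetSum (suc n) 0 h ≡ subsetSum n 0 (h ∘ (false ∷_))
  subsetSum-zero n h =
    trans (sum-map-filter _ h (allSubsets (suc n)))
    (trans (sum-map-allSubsets-suc n _)
    (sym (sum-map-filter _ _ (allSubsets n))))

  subsetSum-const : ∀ n k c → subsetSum n k (λ _ → c) ≡ (n C k) * c
  subsetSum-const zero    zero    c = refl
  subsetSum-const zero    (suc k) c = refl
  subsetSum-const (suc n) zero    c = trans (subsetSum-zero n _) (subsetSum-const n zero c)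
  subsetSum-const (suc n) (suc k) c = begin
    subsetSum (suc n) (suc k) (λ _ → c)  ≡⟨ subsetSum-suc n k _ ⟩
    subsetSum n k (λ _ → c) + subsetSum n (suc k) (λ _ → c)
      ≡⟨ cong₂ _+_ (subsetSum-const n k c) (subsetSum-const n (suc k) c) ⟩
    (n C k) * c + (n C suc k) * c       ≡⟨ *-distribʳ-+ c (n C k) _ ⟨
    (n C k + n C suc k) * c             ≡⟨ cong (_* c) (nCk+nC[k+1]≡[n+1]C[k+1] n k) ⟩
    (suc n C suc k) * c                 ∎
    where open ≡-Reasoning

  subsetSum-⊆ : ∀ n k (M : Subset n) → subsetSum n k (λ A → ⟦ A ⊆? M ⟧) ≡ ∣ M ∣ C k
  subsetSum-⊆ zero    zero    []          = refl
  subsetSum-⊆ zero    (suc k) []          = refl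
  subsetSum-⊆ (suc n) zero    (m ∷ M)     = trans (subsetSum-zero n _) (subsetSum-⊆ n zero M)
  subsetSum-⊆ (suc n) (suc k) (true ∷ M)  =
    trans (subsetSum-suc n k _)
    (trans (cong₂ _+_ (subsetSum-⊆ n k M) (subsetSum-⊆ n (suc k) M)) (nCk+nC[k+1]≡[n+1]C[k+1] ∣ M ∣ k))
  subsetSum-⊆ (suc n) (suc k) (false ∷ M) =
    trans (subsetSum-suc n k _) (cong₂ _+_ (trans (subsetSum-const n k 0) (*-zeroʳ (n C k))) (subsetSum-⊆ n (suc k) M))

  -- Walks on the path

  -- P n i j unfolds to Adjacent (toℕ i) (toℕ j).
  Adjacent : ℕ → ℕ → Set
  Adjacent a b = suc a ≡ b ⊎ suc b ≡ a

  ∣n-1+n∣≡1 : ∀ a → ∣ a - suc a ∣ ≡ 1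
  ∣n-1+n∣≡1 zero    = refl
  ∣n-1+n∣≡1 (suc a) = ∣n-1+n∣≡1 a

  ∣m-1+n∣≡1+∣m-n∣ : ∀ {m n} → m ≤ n → ∣ m - suc n ∣ ≡ suc ∣ m - n ∣
  ∣m-1+n∣≡1+∣m-n∣ z≤n       = refl
  ∣m-1+n∣≡1+∣m-n∣ (s≤s m≤n) = ∣m-1+n∣≡1+∣m-n∣ m≤n

  ∣m-n∣+m≡n : ∀ {m n} → m ≤ n → ∣ m - n ∣ + m ≡ n
  ∣m-n∣+m≡n m≤n = trans (cong (_+ _) (m≤n⇒∣m-n∣≡n∸m m≤n)) (m∸n+n≡m m≤n)

  ∣n-m∣+m≡n : ∀ {m n} → m ≤ n → ∣ n - m ∣ + m ≡ n
  ∣n-m∣+m≡n {m} {n} m≤n = trans (cong (_+ m) (∣-∣-comm n m)) (∣m-n∣+m≡n m≤n)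

  adjacent⇒∣-∣≡1 : ∀ {a b} → Adjacent a b → ∣ a - b ∣ ≡ 1
  adjacent⇒∣-∣≡1 {a}     (inj₁ refl) = ∣n-1+n∣≡1 a
  adjacent⇒∣-∣≡1 {b = b} (inj₂ refl) = trans (∣-∣-comm (suc b) b) (∣n-1+n∣≡1 b)

  module _ {n : ℕ} where

    private
      at : ∀ {m} → Vec (Fin n) m → Fin m → ℕ
      at xs p = toℕ (lookup xs p)

    linked-lipschitz₀ : ∀ {m} {xs : Vec (Fin n) (suc m)} → Linked (P n) xs → ∀ q → ∣ at xs zero - at xs q ∣ ≤ toℕ q
    linked-lipschitz₀ {xs = x ∷ _} _ zero = ≤-reflexive (∣n-n∣≡0 (toℕ x))
    linked-lipschitz₀ (_∷_ {x = x} {xs = y ∷ ys} x~y ys-linked) (suc q) = begin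
      ∣ toℕ x - at (y ∷ ys) q ∣
        ≤⟨ ∣-∣-triangle (toℕ x) (toℕ y) _ ⟩
      ∣ toℕ x - toℕ y ∣ + ∣ toℕ y - at (y ∷ ys) q ∣
        ≤⟨ +-mono-≤ (≤-reflexive (adjacent⇒∣-∣≡1 x~y)) (linked-lipschitz₀ ys-linked q) ⟩
      suc (toℕ q) ∎
      where open ≤-Reasoning

    linked-lipschitz : ∀ {m} {xs : Vec (Fin n) m} → Linked (P n) xs →
                       ∀ p q → ∣ at xs p - at xs q ∣ ≤ ∣ toℕ p - toℕ q ∣
    linked-lipschitz xs-linked zero q = linked-lipschitz₀ xs-linked q
    linked-lipschitz {xs = x ∷ ys} xs-linked (suc p) zero =
      subst₂ _≤_ (∣-∣-comm (toℕ x) _) (∣-∣-comm 0 (suc (toℕ p))) (linked-lipschitz₀ xs-linked (suc p))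
    linked-lipschitz (_ ∷ ys-linked) (suc p) (suc q) = linked-lipschitz ys-linked p q

  lookup-fromℕ : ∀ {A : Set} {m} (xs : Vec A (suc m)) → lookup xs (fromℕ m) ≡ last xs
  lookup-fromℕ (x ∷ [])     = refl
  lookup-fromℕ (x ∷ y ∷ xs) = lookup-fromℕ (y ∷ xs)

  lookup-zero : ∀ {A : Set} {m} (xs : Vec A (suc m)) → lookup xs zero ≡ head xs
  lookup-zero (x ∷ xs) = refl

  detour : ∀ a b x y → 2 * ∣ x - y ∣ ≤ ∣ a - x ∣ + ∣ x - y ∣ + ∣ y - b ∣ + ∣ a - b ∣
  detour a b x y = begin
    2 * ∣ x - y ∣
      ≡⟨ cong (∣ x - y ∣ +_) (+-identityʳ _) ⟩
    ∣ x - y ∣ + ∣ x - y ∣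
      ≤⟨ +-monoʳ-≤ ∣ x - y ∣ (∣-∣-triangle x a y) ⟩
    ∣ x - y ∣ + (∣ x - a ∣ + ∣ a - y ∣)
      ≤⟨ +-monoʳ-≤ ∣ x - y ∣ (+-monoʳ-≤ ∣ x - a ∣ (∣-∣-triangle a b y)) ⟩
    ∣ x - y ∣ + (∣ x - a ∣ + (∣ a - b ∣ + ∣ b - y ∣))
      ≡⟨ cong₂ (λ s t → ∣ x - y ∣ + (s + (∣ a - b ∣ + t))) (∣-∣-comm x a) (∣-∣-comm b y) ⟩
    ∣ x - y ∣ + (∣ a - x ∣ + (∣ a - b ∣ + ∣ y - b ∣))
      ≡⟨ rearrange ∣ x - y ∣ ∣ a - x ∣ ∣ a - b ∣ ∣ y - b ∣ ⟩
    ∣ a - x ∣ + ∣ x - y ∣ + ∣ y - b ∣ + ∣ a - b ∣ ∎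
    where
    open ≤-Reasoning
    rearrange : ∀ d s e t → d + (s + (e + t)) ≡ s + d + t + e
    rearrange = solve-∀

  module _ {n : ℕ} {A : Subset n} {u v : Fin n} {r : ℕ} (w : Walk (P n) A u v r) where
    open Walk w

    private
      at : Fin (suc r) → ℕ
      at p = toℕ (lookup verts p)

    walk-through : ∀ {p q} → toℕ p ≤ toℕ q → ∣ toℕ u - at p ∣ + ∣ at p - at q ∣ + ∣ at q - toℕ v ∣ ≤ r
    walk-through {p} {q} p≤q = begin
      ∣ toℕ u - at p ∣ + ∣ at p - at q ∣ + ∣ at q - toℕ v ∣
        ≡⟨ cong₂ (λ a b → ∣ a - at p ∣ + ∣ at p - at q ∣ + ∣ at q - b ∣) (sym at-start) (sym at-end) ⟩
      ∣ at zero - at p ∣ + ∣ at p - at q ∣ + ∣ at q - at (fromℕ r) ∣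
        ≤⟨ +-mono-≤ (+-mono-≤ (linked-lipschitz steps zero p) (linked-lipschitz steps p q))
                    (linked-lipschitz steps q (fromℕ r)) ⟩
      toℕ p + ∣ toℕ p - toℕ q ∣ + ∣ toℕ q - toℕ (fromℕ r) ∣
        ≡⟨ cong₂ (λ s t → toℕ p + s + t) (m≤n⇒∣m-n∣≡n∸m p≤q)
                 (trans (cong (∣ toℕ q -_∣) (toℕ-fromℕ r)) (m≤n⇒∣m-n∣≡n∸m q≤r)) ⟩
      toℕ p + (toℕ q ∸ toℕ p) + (r ∸ toℕ q)
        ≡⟨ cong (_+ (r ∸ toℕ q)) (m+[n∸m]≡n p≤q) ⟩
      toℕ q + (r ∸ toℕ q)
        ≡⟨ m+[n∸m]≡n q≤r ⟩
      r ∎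
      where
      open ≤-Reasoning
      q≤r : toℕ q ≤ r
      q≤r = s≤s⁻¹ (toℕ<n q)
      at-start : at zero ≡ toℕ u
      at-start = cong toℕ (trans (lookup-zero verts) starts)
      at-end : at (fromℕ r) ≡ toℕ v
      at-end = cong toℕ (trans (lookup-fromℕ verts) ends)

    walk-spread : ∀ p q → 2 * ∣ at p - at q ∣ ≤ r + ∣ toℕ u - toℕ v ∣
    walk-spread p q with ≤-total (toℕ p) (toℕ q)
    ... | inj₁ p≤q = ≤-trans (detour (toℕ u) (toℕ v) (at p) (at q)) (+-monoˡ-≤ _ (walk-through p≤q))
    ... | inj₂ q≤p = begin
      2 * ∣ at p - at q ∣  ≡⟨ cong (2 *_) (∣-∣-comm (at p) (at q)) ⟩
      2 * ∣ at q - at p ∣  ≤⟨ detour (toℕ u) (toℕ v) (at q) (at p) ⟩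
      _                   ≤⟨ +-monoˡ-≤ _ (walk-through q≤p) ⟩
      r + ∣ toℕ u - toℕ v ∣ ∎
      where open ≤-Reasoning

  record Route (n : ℕ) : Set where
    field
      length : ℕ
      at     : ℕ → ℕ
      at<n   : ∀ t → t ≤ length → at t < n
      step   : ∀ t → t < length → Adjacent (at t) (at (suc t))

  open Route

  Passes : ∀ {n} → Route n → ℕ → Set
  Passes ρ y = ∃ λ t → t ≤ length ρ × at ρ t ≡ y

  module _ {n : ℕ} where

    ascend : ∀ a m → a + m < n → Route n
    ascend a m a+m<n = record
      { length = m
      ; at     = a +_
      ; at<n   = λ t t≤m → ≤-<-trans (+-monoʳ-≤ a t≤m) a+m<n
      ; step   = λ t _ → inj₁ (sym (+-suc a t))
      }

    descend : ∀ a m → a < n → m ≤ a → Route n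
    descend a m a<n m≤a = record
      { length = m
      ; at     = a ∸_
      ; at<n   = λ t _ → ≤-<-trans (m∸n≤m a t) a<n
      ; step   = λ t t<m → inj₂ (sym (+-∸-assoc 1 (≤-trans t<m m≤a)))
      }

    straight : ∀ a c → a < n → c < n → Route n
    straight a c a<n c<n with a ≤? c
    ... | yes a≤c = ascend a (c ∸ a) (subst (_< n) (sym (m+[n∸m]≡n a≤c)) c<n)
    ... | no  _   = descend a (a ∸ c) a<n (m∸n≤m a c)

    module _ (a c : ℕ) (a<n : a < n) (c<n : c < n) where

      straight-length : length (straight a c a<n c<n) ≡ ∣ a - c ∣
      straight-length with a ≤? c
      ... | yes a≤c = sym (m≤n⇒∣m-n∣≡n∸m a≤c)
      ... | no  a≰c = sym (m≤n⇒∣n-m∣≡n∸m (<⇒≤ (≰⇒> a≰c)))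

      straight-start : at (straight a c a<n c<n) 0 ≡ a
      straight-start with a ≤? c
      ... | yes _ = +-identityʳ a
      ... | no  _ = refl

      straight-end : at (straight a c a<n c<n) (length (straight a c a<n c<n)) ≡ c
      straight-end with a ≤? c
      ... | yes a≤c = m+[n∸m]≡n a≤c
      ... | no  a≰c = m∸[m∸n]≡n (<⇒≤ (≰⇒> a≰c))

      straight-passes : ∀ y → (a ≤ y × y ≤ c) ⊎ (c ≤ y × y ≤ a) → Passes (straight a c a<n c<n) y
      straight-passes y between with a ≤? c | between
      ... | yes a≤c | inj₁ (a≤y , y≤c) = y ∸ a , ∸-monoˡ-≤ a y≤c , m+[n∸m]≡n a≤y
      ... | yes a≤c | inj₂ (c≤y , y≤a) = 0 , z≤n , trans (+-identityʳ a) (≤-antisym (≤-trans a≤c c≤y) y≤a)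
      ... | no  a≰c | inj₁ (a≤y , y≤c) = contradiction (≤-trans a≤y y≤c) a≰c
      ... | no  a≰c | inj₂ (c≤y , y≤a) = a ∸ y , ∸-monoʳ-≤ a c≤y , m∸[m∸n]≡n y≤a

  module Concat {n : ℕ} (ρ σ : Route n) (joint : at ρ (length ρ) ≡ at σ 0) where

    private
      ℓ = length ρ

    at′ : ℕ → ℕ
    at′ t with t ≤? ℓ
    ... | yes _ = at ρ t
    ... | no  _ = at σ (t ∸ ℓ)

    at′-left : ∀ t → t ≤ ℓ → at′ t ≡ at ρ t
    at′-left t t≤ℓ with t ≤? ℓ
    ... | yes _   = refl
    ... | no  t≰ℓ = contradiction t≤ℓ t≰ℓ

    at′-right : ∀ t → ℓ ≤ t → at′ t ≡ at σ (t ∸ ℓ)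
    at′-right t ℓ≤t with t ≤? ℓ
    ... | no  _   = refl
    ... | yes t≤ℓ with ≤-antisym t≤ℓ ℓ≤t
    ...   | refl = trans joint (cong (at σ) (sym (n∸n≡0 t)))

    route : Route n
    route = record
      { length = ℓ + length σ
      ; at     = at′
      ; at<n   = bounded
      ; step   = adjacent
      }
      where
      bounded : ∀ t → t ≤ ℓ + length σ → at′ t < n
      bounded t t≤ with t ≤? ℓ
      ... | yes t≤ℓ = at<n ρ t t≤ℓ
      ... | no  _   = at<n σ (t ∸ ℓ) (subst (t ∸ ℓ ≤_) (m+n∸m≡n ℓ (length σ)) (∸-monoˡ-≤ ℓ t≤))

      adjacent : ∀ t → t < ℓ + length σ → Adjacent (at′ t) (at′ (suc t))
      adjacent t t< = by-cases (suc t ≤? ℓ)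
        where
        by-cases : Dec (suc t ≤ ℓ) → Adjacent (at′ t) (at′ (suc t))
        by-cases (yes t<ℓ) = subst₂ Adjacent (sym (at′-left t (<⇒≤ t<ℓ))) (sym (at′-left (suc t) t<ℓ)) (step ρ t t<ℓ)
        by-cases (no  t≮ℓ) = subst₂ Adjacent (sym (at′-right t ℓ≤t))
            (sym (trans (at′-right (suc t) (m≤n⇒m≤1+n ℓ≤t)) (cong (at σ) (+-∸-assoc 1 ℓ≤t))))
            (step σ (t ∸ ℓ) (subst (t ∸ ℓ <_) (m+n∸m≡n ℓ (length σ)) (∸-monoˡ-< t< ℓ≤t)))
          where ℓ≤t = s≤s⁻¹ (≰⇒> t≮ℓ)

    route-start : at route 0 ≡ at ρ 0
    route-start = at′-left 0 z≤n

    route-end : at route (length route) ≡ at σ (length σ)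
    route-end = trans (at′-right (ℓ + length σ) (m≤m+n ℓ (length σ))) (cong (at σ) (m+n∸m≡n ℓ (length σ)))

    passes-left : ∀ {y} → Passes ρ y → Passes route y
    passes-left (t , t≤ℓ , eq) = t , ≤-trans t≤ℓ (m≤m+n ℓ (length σ)) , trans (at′-left t t≤ℓ) eq

    passes-right : ∀ {y} → Passes σ y → Passes route y
    passes-right (t , t≤ , eq) =
      ℓ + t , +-monoʳ-≤ ℓ t≤ , trans (at′-right (ℓ + t) (m≤m+n ℓ t)) (trans (cong (at σ) (m+n∸m≡n ℓ t)) eq)

  linked-tabulate : ∀ {A : Set} {R : A → A → Set} m (f : Fin (suc m) → A) →
                    (∀ i → R (f (inject₁ i)) (f (suc i))) → Linked R (Vec.tabulate f)
  linked-tabulate zero    f f~ = [-]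
  linked-tabulate (suc m) f f~ = f~ zero ∷ linked-tabulate m (f ∘ suc) (f~ ∘ suc)

  route-walk : ∀ {n} (A : Subset n) (u v : Fin n) (ρ : Route n) →
               at ρ 0 ≡ toℕ u → at ρ (length ρ) ≡ toℕ v → (∀ x → x ∈ A → Passes ρ (toℕ x)) →
               Walk (P n) A u v (length ρ)
  route-walk {n} A u v ρ from to covers = record
    { verts  = Vec.tabulate vertex
    ; starts = toℕ-injective (trans (toℕ-vertex≡at zero) from)
    ; ends   = trans (sym (lookup-fromℕ (Vec.tabulate vertex)))
                 (toℕ-injective (trans (toℕ-lookup (fromℕ ℓ)) (trans (cong (at ρ) (toℕ-fromℕ ℓ)) to)))
    ; steps  = linked-tabulate ℓ vertex λ i →
        subst₂ Adjacent (sym (trans (toℕ-vertex≡at (inject₁ i)) (cong (at ρ) (toℕ-inject₁ i))))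
                        (sym (toℕ-vertex≡at (suc i))) (step ρ (toℕ i) (toℕ<n i))
    ; visits = λ x x∈A → let (t , t≤ℓ , eq) = covers x x∈A in
        fromℕ< (s≤s t≤ℓ) ,
        toℕ-injective (trans (toℕ-lookup (fromℕ< (s≤s t≤ℓ))) (trans (cong (at ρ) (toℕ-fromℕ< (s≤s t≤ℓ))) eq))
    }
    where
    ℓ = length ρ
    vertex : Fin (suc ℓ) → Fin n
    vertex t = fromℕ< (at<n ρ (toℕ t) (s≤s⁻¹ (toℕ<n t)))
    toℕ-vertex≡at : ∀ t → toℕ (vertex t) ≡ at ρ (toℕ t)
    toℕ-vertex≡at t = toℕ-fromℕ< _
    toℕ-lookup : ∀ t → toℕ (lookup (Vec.tabulate vertex) t) ≡ at ρ (toℕ t)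
    toℕ-lookup t = trans (cong toℕ (lookup∘tabulate vertex t)) (toℕ-vertex≡at t)

  tour-walk : ∀ {n} (A : Subset n) (u v : Fin n) {X Y} (X<n : X < n) (Y<n : Y < n) →
              (∀ x → x ∈ A → (X ≤ toℕ x × toℕ x ≤ Y) ⊎ (Y ≤ toℕ x × toℕ x ≤ X)) →
              Walk (P n) A u v (∣ toℕ u - X ∣ + ∣ X - Y ∣ + ∣ Y - toℕ v ∣)
  tour-walk A u v {X} {Y} X<n Y<n between =
    subst (Walk _ A u v) tour-length (route-walk A u v tour tour-start tour-end covers)
    where
    a = toℕ u
    b = toℕ v
    leg₁ = straight a X (toℕ<n u) X<n
    leg₂ = straight X Y X<n Y<n
    leg₃ = straight Y b Y<n (toℕ<n v)
    module C₁ = Concat leg₁ leg₂ (trans (straight-end a X _ _) (sym (straight-start X Y _ _)))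
    module C₂ = Concat C₁.route leg₃ (trans C₁.route-end (trans (straight-end X Y _ _) (sym (straight-start Y b _ _))))
    tour = C₂.route
    tour-start : at tour 0 ≡ a
    tour-start = trans C₂.route-start (trans C₁.route-start (straight-start a X _ _))
    tour-end : at tour (length tour) ≡ b
    tour-end = trans C₂.route-end (straight-end Y b _ _)
    covers : ∀ x → x ∈ A → Passes tour (toℕ x)
    covers x x∈A = C₂.passes-left (C₁.passes-right (straight-passes X Y _ _ (toℕ x) (between x x∈A)))
    tour-length : length tour ≡ ∣ a - X ∣ + ∣ X - Y ∣ + ∣ Y - b ∣
    tour-length = cong₂ _+_ (cong₂ _+_ (straight-length a X _ _) (straight-length X Y _ _)) (straight-length Y b _ _)

  tour-exact : ∀ {l a b r} → l ≤ a → a ≤ b → b ≤ r →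
               ∣ a - l ∣ + ∣ l - r ∣ + ∣ r - b ∣ + ∣ a - b ∣ + 2 * l ≡ 2 * r
  tour-exact {l} {a} {b} {r} l≤a a≤b b≤r = +-cancelʳ-≡ (a + b) _ _ (begin
    ∣ a - l ∣ + ∣ l - r ∣ + ∣ r - b ∣ + ∣ a - b ∣ + 2 * l + (a + b)
      ≡⟨ regroup ∣ a - l ∣ ∣ l - r ∣ ∣ r - b ∣ ∣ a - b ∣ l a b ⟩
    (∣ a - l ∣ + l) + (∣ l - r ∣ + l) + (∣ r - b ∣ + b) + (∣ a - b ∣ + a)
      ≡⟨ cong₂ _+_ (cong₂ _+_ (cong₂ _+_ (∣n-m∣+m≡n l≤a) (∣m-n∣+m≡n l≤r)) (∣n-m∣+m≡n b≤r))
                   (∣m-n∣+m≡n a≤b) ⟩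
    a + r + r + b
      ≡⟨ collect a b r ⟩
    2 * r + (a + b) ∎)
    where
    open ≡-Reasoning
    l≤r = ≤-trans l≤a (≤-trans a≤b b≤r)
    regroup : ∀ d₁ d₂ d₃ d₄ l a b →
              d₁ + d₂ + d₃ + d₄ + 2 * l + (a + b) ≡ (d₁ + l) + (d₂ + l) + (d₃ + b) + (d₄ + a)
    regroup = solve-∀
    collect : ∀ a b r → a + r + r + b ≡ 2 * r + (a + b)
    collect = solve-∀

  tour-exact′ : ∀ {l a b r} → l ≤ b → b ≤ a → a ≤ r →
                ∣ a - r ∣ + ∣ r - l ∣ + ∣ l - b ∣ + ∣ a - b ∣ + 2 * l ≡ 2 * r
  tour-exact′ {l} {a} {b} {r} l≤b b≤a a≤r = trans (cong (_+ 2 * l) reverse-tour) (tour-exact l≤b b≤a a≤r)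
    where
    rearrange : ∀ w x y z → w + x + y + z ≡ y + x + w + z
    rearrange = solve-∀
    reverse-tour : ∣ a - r ∣ + ∣ r - l ∣ + ∣ l - b ∣ + ∣ a - b ∣ ≡ ∣ b - l ∣ + ∣ l - r ∣ + ∣ r - a ∣ + ∣ b - a ∣
    reverse-tour = trans
      (cong₂ _+_ (cong₂ _+_ (cong₂ _+_ (∣-∣-comm a r) (∣-∣-comm r l)) (∣-∣-comm l b)) (∣-∣-comm a b))
      (rearrange ∣ r - a ∣ ∣ l - r ∣ ∣ b - l ∣ ∣ b - a ∣)

  -- The extent of A ∪ {u, v}

  module Extent {n : ℕ} (A : Subset n) (u v : Fin n) where

    Marked : Fin n → Set
    Marked x = x ≡ u ⊎ x ≡ v ⊎ x ∈ A

    private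
      others : List (Fin n)
      others = v ∷ filter (_∈? A) (allFin n)

      others-marked : All Marked others
      others-marked = inj₂ (inj₁ refl) ∷ All.map (inj₂ ∘ inj₂) (all-filter (_∈? A) (allFin n))

      others-lookup : ∀ {Q : Fin n → Set} → All Q others → ∀ {x} → x ≡ v ⊎ x ∈ A → Q x
      others-lookup (Qv ∷ _)  (inj₁ refl) = Qv
      others-lookup (_ ∷ Q*) (inj₂ x∈A)  = All.lookup Q* (∈-filter⁺ (_∈? A) (∈-allFin _) x∈A)

    leftmost rightmost : Fin n
    leftmost  = argmin toℕ u others
    rightmost = argmax toℕ u others

    L R : ℕ
    L = toℕ leftmost
    R = toℕ rightmost

    leftmost-marked : Marked leftmost
    leftmost-marked = argmin-all toℕ (inj₁ refl) others-marked

    rightmost-marked : Marked rightmost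
    rightmost-marked = argmax-all toℕ (inj₁ refl) others-marked

    leftmost-≤ : ∀ {x} → Marked x → L ≤ toℕ x
    leftmost-≤ (inj₁ refl) = f[argmin]≤f[⊤] {f = toℕ} u others
    leftmost-≤ (inj₂ x)    = others-lookup (f[argmin]≤f[xs] {f = toℕ} u others) x

    ≤-rightmost : ∀ {x} → Marked x → toℕ x ≤ R
    ≤-rightmost (inj₁ refl) = f[⊥]≤f[argmax] {f = toℕ} u others
    ≤-rightmost (inj₂ x)    = others-lookup (f[xs]≤f[argmax] {f = toℕ} u others) x

    L≤R : L ≤ R
    L≤R = ≤-trans (leftmost-≤ (inj₁ refl)) (≤-rightmost (inj₁ refl))

    walk-lower-bound : ∀ {r} → Walk (P n) A u v r → 2 * R ≤ r + ∣ toℕ u - toℕ v ∣ + 2 * L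
    walk-lower-bound {r} w = begin
      2 * R                          ≡⟨ cong (2 *_) (∣m-n∣+m≡n L≤R) ⟨
      2 * (∣ L - R ∣ + L)            ≡⟨ *-distribˡ-+ 2 ∣ L - R ∣ L ⟩
      2 * ∣ L - R ∣ + 2 * L          ≤⟨ +-monoˡ-≤ (2 * L) spread ⟩
      r + ∣ toℕ u - toℕ v ∣ + 2 * L  ∎
      where
      open ≤-Reasoning
      open Walk w
      visited : ∀ {x} → Marked x → ∃ λ p → lookup verts p ≡ x
      visited (inj₁ refl)        = zero , trans (lookup-zero verts) starts
      visited (inj₂ (inj₁ refl)) = fromℕ r , trans (lookup-fromℕ verts) ends
      visited (inj₂ (inj₂ x∈A))  = visits _ x∈A
      spread : 2 * ∣ L - R ∣ ≤ r + ∣ toℕ u - toℕ v ∣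
      spread with visited leftmost-marked | visited rightmost-marked
      ... | p , p↦L | q , q↦R = subst₂ (λ s t → 2 * ∣ toℕ s - toℕ t ∣ ≤ _) p↦L q↦R (walk-spread w p q)

    in-extent : ∀ {x} → x ∈ A → L ≤ toℕ x × toℕ x ≤ R
    in-extent x∈A = leftmost-≤ (inj₂ (inj₂ x∈A)) , ≤-rightmost (inj₂ (inj₂ x∈A))

    tour-upper-bound : ∃ λ s → Walk (P n) A u v s × s + ∣ toℕ u - toℕ v ∣ + 2 * L ≡ 2 * R
    tour-upper-bound with ≤-total (toℕ u) (toℕ v)
    ... | inj₁ u≤v = _ , tour-walk A u v (toℕ<n leftmost) (toℕ<n rightmost) (λ _ → inj₁ ∘ in-extent) ,
                     tour-exact (leftmost-≤ (inj₁ refl)) u≤v (≤-rightmost (inj₂ (inj₁ refl)))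
    ... | inj₂ v≤u = _ , tour-walk A u v (toℕ<n rightmost) (toℕ<n leftmost) (λ _ → inj₂ ∘ in-extent) ,
                     tour-exact′ (leftmost-≤ (inj₂ (inj₁ refl))) v≤u (≤-rightmost (inj₁ refl))

    ρ-on-path : ∀ {r} → IsRho (P n) A u v r → r + ∣ toℕ u - toℕ v ∣ + 2 * L ≡ 2 * R
    ρ-on-path (w , minimal) with tour-upper-bound
    ... | s , tour , s-exact = ≤-antisym
      (≤-trans (+-monoˡ-≤ (2 * L) (+-monoˡ-≤ ∣ toℕ u - toℕ v ∣ (minimal s tour))) (≤-reflexive s-exact))
      (walk-lower-bound w)

    marked-induction : ∀ {Q : Fin n → Set} → Q u → Q v → (∀ {x} → x ∈ A → Q x) → ∀ {x} → Marked x → Q x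
    marked-induction Qu _  _  (inj₁ refl)        = Qu
    marked-induction _  Qv _  (inj₂ (inj₁ refl)) = Qv
    marked-induction _  _  QA (inj₂ (inj₂ x∈A))  = QA x∈A

    rightmost≤⇔ : ∀ x → R ≤ x ⇔ (toℕ u ≤ x × toℕ v ≤ x × A ⊆ atMost n x)
    rightmost≤⇔ x = mk⇔
      (λ R≤x → ≤-trans (≤-rightmost (inj₁ refl)) R≤x , ≤-trans (≤-rightmost (inj₂ (inj₁ refl))) R≤x ,
               λ {i} i∈A → ∈-tabulate⁺ (λ i → toℕ i ≤? x) (≤-trans (proj₂ (in-extent i∈A)) R≤x))
      (λ (u≤x , v≤x , A⊆) → marked-induction u≤x v≤x (∈-tabulate⁻ (λ i → toℕ i ≤? x) ∘ A⊆) rightmost-marked)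

    <leftmost⇔ : ∀ x → x < L ⇔ (x < toℕ u × x < toℕ v × A ⊆ above n x)
    <leftmost⇔ x = mk⇔
      (λ x<L → <-≤-trans x<L (leftmost-≤ (inj₁ refl)) , <-≤-trans x<L (leftmost-≤ (inj₂ (inj₁ refl))) ,
               λ {i} i∈A → ∈-tabulate⁺ (λ i → x <? toℕ i) (<-≤-trans x<L (proj₁ (in-extent i∈A))))
      (λ (x<u , x<v , A⊆) → marked-induction x<u x<v (∈-tabulate⁻ (λ i → x <? toℕ i) ∘ A⊆) leftmost-marked)

    ⟦rightmost≤?⟧ : ∀ x → ⟦ R ≤? x ⟧ ≡ ⟦ toℕ u ≤? x ⟧ * (⟦ toℕ v ≤? x ⟧ * ⟦ A ⊆? atMost n x ⟧)
    ⟦rightmost≤?⟧ x = trans (⟦⟧-cong (R ≤? x) (u≤? ×-dec v≤? ×-dec A⊆?) (rightmost≤⇔ x))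
                           (trans (⟦×-dec⟧ u≤? (v≤? ×-dec A⊆?)) (cong (⟦ u≤? ⟧ *_) (⟦×-dec⟧ v≤? A⊆?)))
      where
      u≤? = toℕ u ≤? x
      v≤? = toℕ v ≤? x
      A⊆? = A ⊆? atMost n x

    ⟦<?leftmost⟧ : ∀ x → ⟦ x <? L ⟧ ≡ ⟦ x <? toℕ u ⟧ * (⟦ x <? toℕ v ⟧ * ⟦ A ⊆? above n x ⟧)
    ⟦<?leftmost⟧ x = trans (⟦⟧-cong (x <? L) (<u? ×-dec <v? ×-dec A⊆?) (<leftmost⇔ x))
                          (trans (⟦×-dec⟧ <u? (<v? ×-dec A⊆?)) (cong (⟦ <u? ⟧ *_) (⟦×-dec⟧ <v? A⊆?)))
      where
      <u? = x <? toℕ u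
      <v? = x <? toℕ v
      A⊆? = A ⊆? above n x

    ρ-by-thresholds : ∀ {r} → IsRho (P n) A u v r →
                      r + ∣ toℕ u - toℕ v ∣ + 2 * ∑[ i < n ] (⟦ R ≤? toℕ i ⟧ + ⟦ toℕ i <? L ⟧) ≡ 2 * n
    ρ-by-thresholds {r} isρ = begin
      r + d + 2 * ∑[ i < n ] (⟦ R ≤? toℕ i ⟧ + ⟦ toℕ i <? L ⟧)
        ≡⟨ cong (λ t → r + d + 2 * t) (∑-distrib-+ {n} _ _) ⟩
      r + d + 2 * (G + ∑[ i < n ] ⟦ toℕ i <? L ⟧)  ≡⟨ cong (λ t → r + d + 2 * (G + t)) below-L ⟩
      r + d + 2 * (G + L)                          ≡⟨ regroup r d G L ⟩
      (r + d + 2 * L) + 2 * G                      ≡⟨ cong (_+ 2 * G) (ρ-on-path isρ) ⟩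
      2 * R + 2 * G                                ≡⟨ *-distribˡ-+ 2 R G ⟨
      2 * (R + G)                                  ≡⟨ cong (2 *_) (trans (+-comm R G) above-R) ⟩
      2 * n                                        ∎
      where
      open ≡-Reasoning
      d = ∣ toℕ u - toℕ v ∣
      G = ∑[ i < n ] ⟦ R ≤? toℕ i ⟧
      below-L : ∑[ i < n ] ⟦ toℕ i <? L ⟧ ≡ L
      below-L = trans (∑-⟦<?⟧ n L) (m≥n⇒m⊓n≡n (<⇒≤ (toℕ<n leftmost)))
      above-R : G + R ≡ n
      above-R = trans (cong (G +_) (sym (m≥n⇒m⊓n≡n (<⇒≤ (toℕ<n rightmost))))) (∑-⟦≥?⟧ n R)
      regroup : ∀ r d G L → r + d + 2 * (G + L) ≡ (r + d + 2 * L) + 2 * G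
      regroup = solve-∀

  -- Summing ρ over all pairs and all k-subsets

  Dist : ℕ → ℕ
  Dist n = ∑[ a < n ] ∑[ b < n ] ∣ toℕ a - toℕ b ∣

  -- The number of pairs (u, v) with A ∪ {u, v} ⊆ [0, i], plus the number with A ∪ {u, v} ⊆ (i, n).
  confinedPairs : ∀ n → Subset n → Fin n → ℕ
  confinedPairs n A i = suc (toℕ i) * (suc (toℕ i) * ⟦ A ⊆? atMost n (toℕ i) ⟧)
                      + (n ∸ suc (toℕ i)) * ((n ∸ suc (toℕ i)) * ⟦ A ⊆? above n (toℕ i) ⟧)

  module _ {n : ℕ} (A : Subset n) where
    open Extent A using (R; L; ⟦rightmost≤?⟧; ⟦<?leftmost⟧; ρ-by-thresholds)

    confinedPairs-count : ∀ i →
      ∑[ u < n ] ∑[ v < n ] (⟦ R u v ≤? toℕ i ⟧ + ⟦ toℕ i <? L u v ⟧) ≡ confinedPairs n A i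
    confinedPairs-count i = begin
      ∑[ u < n ] ∑[ v < n ] (⟦ R u v ≤? x ⟧ + ⟦ x <? L u v ⟧)
        ≡⟨ ∑²-distrib-+ {n} (λ u v → ⟦ R u v ≤? x ⟧) (λ u v → ⟦ x <? L u v ⟧) ⟩
      ∑[ u < n ] ∑[ v < n ] ⟦ R u v ≤? x ⟧ + ∑[ u < n ] ∑[ v < n ] ⟦ x <? L u v ⟧
        ≡⟨ cong₂ _+_ (sum-cong-≗ {n} λ u → sum-cong-≗ {n} λ v → ⟦rightmost≤?⟧ u v x)
                     (sum-cong-≗ {n} λ u → sum-cong-≗ {n} λ v → ⟦<?leftmost⟧ u v x) ⟩
      ∑[ u < n ] ∑[ v < n ] (⟦ toℕ u ≤? x ⟧ * (⟦ toℕ v ≤? x ⟧ * ⟦ A ⊆? atMost n x ⟧))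
        + ∑[ u < n ] ∑[ v < n ] (⟦ x <? toℕ u ⟧ * (⟦ x <? toℕ v ⟧ * ⟦ A ⊆? above n x ⟧))
        ≡⟨ cong₂ _+_ (∑²-product {n} (λ u → ⟦ toℕ u ≤? x ⟧) (λ v → ⟦ toℕ v ≤? x ⟧) ⟦ A ⊆? atMost n x ⟧)
                     (∑²-product {n} (λ u → ⟦ x <? toℕ u ⟧) (λ v → ⟦ x <? toℕ v ⟧) ⟦ A ⊆? above n x ⟧) ⟩
      (∑[ u < n ] ⟦ toℕ u ≤? x ⟧) * ((∑[ v < n ] ⟦ toℕ v ≤? x ⟧) * ⟦ A ⊆? atMost n x ⟧)
        + (∑[ u < n ] ⟦ x <? toℕ u ⟧) * ((∑[ v < n ] ⟦ x <? toℕ v ⟧) * ⟦ A ⊆? above n x ⟧)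
        ≡⟨ cong₂ _+_ (cong₂ (λ a b → a * (b * ⟦ A ⊆? atMost n x ⟧)) (count-≤ i) (count-≤ i))
                     (cong₂ (λ a b → a * (b * ⟦ A ⊆? above n x ⟧)) (count-< i) (count-< i)) ⟩
      confinedPairs n A i ∎
      where
      open ≡-Reasoning
      x = toℕ i

    pairSum-identity : (ρ : Fin n → Fin n → ℕ) → (∀ u v → IsRho (P n) A u v (ρ u v)) →
                       ∑[ u < n ] ∑[ v < n ] ρ u v + Dist n + 2 * ∑[ i < n ] confinedPairs n A i ≡ n * (n * (2 * n))
    pairSum-identity ρ isρ = begin
      ∑∑ ρ + Dist n + 2 * ∑[ i < n ] confinedPairs n A i
        ≡⟨ cong (λ t → ∑∑ ρ + Dist n + 2 * t)
                (trans (∑²-comm-∑ {n} n (λ u v i → ⟦ R u v ≤? toℕ i ⟧ + ⟦ toℕ i <? L u v ⟧))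
                       (sum-cong-≗ {n} confinedPairs-count)) ⟨
      ∑∑ ρ + Dist n + 2 * ∑∑ (λ u v → Φ u v)
        ≡⟨ cong (∑∑ ρ + Dist n +_) (*-distribˡ-∑² {n} 2 Φ) ⟩
      ∑∑ ρ + Dist n + ∑∑ (λ u v → 2 * Φ u v)
        ≡⟨ cong (_+ ∑∑ (λ u v → 2 * Φ u v)) (∑²-distrib-+ {n} ρ _) ⟨
      ∑∑ (λ u v → ρ u v + ∣ toℕ u - toℕ v ∣) + ∑∑ (λ u v → 2 * Φ u v)
        ≡⟨ ∑²-distrib-+ {n} _ _ ⟨
      ∑∑ (λ u v → ρ u v + ∣ toℕ u - toℕ v ∣ + 2 * Φ u v)
        ≡⟨ sum-cong-≗ {n} (λ u → sum-cong-≗ {n} λ v → ρ-by-thresholds u v (isρ u v)) ⟩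
      ∑∑ (λ _ _ → 2 * n)
        ≡⟨ trans (sum-cong-≗ {n} λ _ → ∑-const n (2 * n)) (∑-const n (n * (2 * n))) ⟩
      n * (n * (2 * n)) ∎
      where
      open ≡-Reasoning
      ∑∑ : (Fin n → Fin n → ℕ) → ℕ
      ∑∑ f = ∑[ u < n ] ∑[ v < n ] f u v
      Φ : Fin n → Fin n → ℕ
      Φ u v = ∑[ i < n ] (⟦ R u v ≤? toℕ i ⟧ + ⟦ toℕ i <? L u v ⟧)

  squareBinomialSum : ℕ → ℕ → ℕ
  squareBinomialSum k n = ∑[ i < n ] (toℕ i * (toℕ i * (toℕ i C k)))

  pairSum≡∑² : ∀ {n} (f : Fin n → Fin n → ℕ) → pairSum f ≡ ∑[ u < n ] ∑[ v < n ] f u v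
  pairSum≡∑² {n} f = trans (sum-map-cong (allFin n) (λ u → sum-map-tabulate n id (f u))) (sum-map-tabulate n id _)

  ∣atMost∣ : ∀ {n} (i : Fin n) → ∣ atMost n (toℕ i) ∣ ≡ suc (toℕ i)
  ∣atMost∣ {n} i = trans (∣tabulate∣ {n} (λ j → toℕ j ≤? toℕ i)) (count-≤ i)

  ∣above∣ : ∀ {n} (i : Fin n) → ∣ above n (toℕ i) ∣ ≡ n ∸ suc (toℕ i)
  ∣above∣ {n} i = trans (∣tabulate∣ {n} (λ j → toℕ i <? toℕ j)) (count-< i)

  subsetSum-confinedPairs : ∀ n k (i : Fin n) →
    subsetSum n k (λ A → confinedPairs n A i)
      ≡ suc (toℕ i) * (suc (toℕ i) * (suc (toℕ i) C k))
        + (n ∸ suc (toℕ i)) * ((n ∸ suc (toℕ i)) * ((n ∸ suc (toℕ i)) C k))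
  subsetSum-confinedPairs n k i = trans (sum-map-+ (subsetsOfSize n k) _ _) (cong₂ _+_
    (weighted a (atMost n (toℕ i)) (∣atMost∣ i)) (weighted b (above n (toℕ i)) (∣above∣ i)))
    where
    a = suc (toℕ i)
    b = n ∸ suc (toℕ i)
    weighted : ∀ c M → ∣ M ∣ ≡ c → subsetSum n k (λ A → c * (c * ⟦ A ⊆? M ⟧)) ≡ c * (c * (c C k))
    weighted c M ∣M∣≡c = trans (sum-map-*ˡ (subsetsOfSize n k) c _) (cong (c *_)
      (trans (sum-map-*ˡ (subsetsOfSize n k) c _) (cong (c *_) (trans (subsetSum-⊆ n k M) (cong (_C k) ∣M∣≡c)))))

  ∑-confinedPairs : ∀ n k →
    subsetSum n k (λ A → ∑[ i < n ] confinedPairs n A i) ≡ squareBinomialSum k (suc n) + squareBinomialSum k n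
  ∑-confinedPairs n k = begin
    subsetSum n k (λ A → ∑[ i < n ] confinedPairs n A i)
      ≡⟨ sum-map-∑ (subsetsOfSize n k) n (λ A i → confinedPairs n A i) ⟩
    ∑[ i < n ] subsetSum n k (λ A → confinedPairs n A i)
      ≡⟨ sum-cong-≗ {n} (subsetSum-confinedPairs n k) ⟩
    ∑[ i < n ] (g (suc (toℕ i)) + g (n ∸ suc (toℕ i)))
      ≡⟨ ∑-distrib-+ {n} (λ i → g (suc (toℕ i))) (λ i → g (n ∸ suc (toℕ i))) ⟩
    ∑[ i < n ] g (suc (toℕ i)) + ∑[ i < n ] g (n ∸ suc (toℕ i))
      ≡⟨ cong (squareBinomialSum k (suc n) +_) (∑-toℕ-reverse n g) ⟩
    squareBinomialSum k (suc n) + squareBinomialSum k n ∎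
    where
    open ≡-Reasoning
    g : ℕ → ℕ
    g m = m * (m * (m C k))

  twiceWρk-identity : ∀ n k (ρ : Subset n → Fin n → Fin n → ℕ) → (∀ A u v → IsRho (P n) A u v (ρ A u v)) →
    twiceWρk n k ρ + (n C k) * Dist n + 2 * (squareBinomialSum k (suc n) + squareBinomialSum k n) ≡ (n C k) * (n * (n * (2 * n)))
  twiceWρk-identity n k ρ isρ = begin
    twiceWρk n k ρ + (n C k) * Dist n + 2 * (squareBinomialSum k (suc n) + squareBinomialSum k n)
      ≡⟨ cong₂ (λ s t → s + t + 2 * (squareBinomialSum k (suc n) + squareBinomialSum k n))
               (sum-map-cong 𝒜 (λ A → pairSum≡∑² (ρ A))) (sym (subsetSum-const n k (Dist n))) ⟩
    subsetSum n k ∑∑ρ + subsetSum n k (λ _ → Dist n) + 2 * (squareBinomialSum k (suc n) + squareBinomialSum k n)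
      ≡⟨ cong (λ t → subsetSum n k ∑∑ρ + subsetSum n k (λ _ → Dist n) + 2 * t) (∑-confinedPairs n k) ⟨
    subsetSum n k ∑∑ρ + subsetSum n k (λ _ → Dist n) + 2 * subsetSum n k Φ
      ≡⟨ cong₂ _+_ (sum-map-+ 𝒜 ∑∑ρ (λ _ → Dist n)) (sum-map-*ˡ 𝒜 2 Φ) ⟨
    subsetSum n k (λ A → ∑∑ρ A + Dist n) + subsetSum n k (λ A → 2 * Φ A)
      ≡⟨ sum-map-+ 𝒜 _ _ ⟨
    subsetSum n k (λ A → ∑∑ρ A + Dist n + 2 * Φ A)
      ≡⟨ sum-map-cong 𝒜 (λ A → pairSum-identity A (ρ A) (isρ A)) ⟩
    subsetSum n k (λ _ → n * (n * (2 * n)))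
      ≡⟨ subsetSum-const n k _ ⟩
    (n C k) * (n * (n * (2 * n))) ∎
    where
    open ≡-Reasoning
    𝒜 = subsetsOfSize n k
    ∑∑ρ : Subset n → ℕ
    ∑∑ρ A = ∑[ u < n ] ∑[ v < n ] ρ A u v
    Φ : Subset n → ℕ
    Φ A = ∑[ i < n ] confinedPairs n A i

  -- Closed forms

  distTo : ℕ → ℕ
  distTo n = ∑[ a < n ] ∣ toℕ a - n ∣

  2*distTo : ∀ n → 2 * distTo n ≡ n * suc n
  2*distTo zero    = refl
  2*distTo (suc n) = begin
    2 * distTo (suc n)
      ≡⟨ cong (2 *_) (∑-toℕ-last n (∣_- suc n ∣)) ⟩
    2 * (∑[ a < n ] ∣ toℕ a - suc n ∣ + ∣ n - suc n ∣)
      ≡⟨ cong₂ (λ s t → 2 * (s + t)) (trans (sum-cong-≗ {n} λ a → ∣m-1+n∣≡1+∣m-n∣ (<⇒≤ (toℕ<n a))) (∑-suc n _))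
                                      (∣n-1+n∣≡1 n) ⟩
    2 * (n + distTo n + 1)   ≡⟨ regroup n (distTo n) ⟩
    2 * distTo n + 2 * n + 2 ≡⟨ cong (λ t → t + 2 * n + 2) (2*distTo n) ⟩
    n * suc n + 2 * n + 2    ≡⟨ expand n ⟩
    suc n * suc (suc n)      ∎
    where
    open ≡-Reasoning
    regroup : ∀ n d → 2 * (n + d + 1) ≡ 2 * d + 2 * n + 2
    regroup = solve-∀
    expand : ∀ n → n * suc n + 2 * n + 2 ≡ suc n * suc (suc n)
    expand = solve-∀

  Dist-suc : ∀ n → Dist (suc n) ≡ Dist n + distTo n + distTo n
  Dist-suc n = begin
    ∑[ a < suc n ] ∑[ b < suc n ] ∣ toℕ a - toℕ b ∣
      ≡⟨ sum-cong-≗ {suc n} (λ a → ∑-toℕ-last n (∣ toℕ a -_∣)) ⟩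
    ∑[ a < suc n ] (∑[ b < n ] ∣ toℕ a - toℕ b ∣ + ∣ toℕ a - n ∣)
      ≡⟨ ∑-toℕ-last n (λ x → ∑[ b < n ] ∣ x - toℕ b ∣ + ∣ x - n ∣) ⟩
    ∑[ a < n ] (∑[ b < n ] ∣ toℕ a - toℕ b ∣ + ∣ toℕ a - n ∣) + (∑[ b < n ] ∣ n - toℕ b ∣ + ∣ n - n ∣)
      ≡⟨ cong₂ _+_ (∑-distrib-+ {n} _ _) (cong₂ _+_ (sum-cong-≗ {n} λ b → ∣-∣-comm n (toℕ b)) (∣n-n∣≡0 n)) ⟩
    Dist n + distTo n + (distTo n + 0)
      ≡⟨ cong (Dist n + distTo n +_) (+-identityʳ (distTo n)) ⟩
    Dist n + distTo n + distTo n ∎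
    where open ≡-Reasoning

  3*Dist+n : ∀ n → 3 * Dist n + n ≡ n * n * n
  3*Dist+n zero    = refl
  3*Dist+n (suc n) = begin
    3 * Dist (suc n) + suc n                      ≡⟨ cong (λ t → 3 * t + suc n) (Dist-suc n) ⟩
    3 * (Dist n + distTo n + distTo n) + suc n    ≡⟨ regroup (Dist n) (distTo n) n ⟩
    (3 * Dist n + n) + 3 * (2 * distTo n) + 1     ≡⟨ cong₂ (λ s t → s + 3 * t + 1) (3*Dist+n n) (2*distTo n) ⟩
    n * n * n + 3 * (n * suc n) + 1               ≡⟨ expand n ⟩
    suc n * suc n * suc n                         ∎
    where
    open ≡-Reasoning
    regroup : ∀ D d n → 3 * (D + d + d) + suc n ≡ (3 * D + n) + 3 * (2 * d) + 1
    regroup = solve-∀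
    expand : ∀ n → n * n * n + 3 * (n * suc n) + 1 ≡ suc n * suc n * suc n
    expand = solve-∀

  binomial-absorption : ∀ m k → suc k * (m C suc k) + k * (m C k) ≡ m * (m C k)
  binomial-absorption zero    zero    = refl
  binomial-absorption zero    (suc k) = cong₂ _+_ (*-zeroʳ (2 + k)) (*-zeroʳ (1 + k))
  binomial-absorption (suc m) zero    =
    trans (+-identityʳ _) (trans (+-identityʳ _) (trans (nC1≡n (suc m)) (sym (*-identityʳ (suc m)))))
  binomial-absorption (suc m) (suc k) = begin
    (2 + k) * (suc m C (2 + k)) + (1 + k) * (suc m C (1 + k))
      ≡⟨ cong₂ (λ x y → (2 + k) * x + (1 + k) * y) (nCk+nC[k+1]≡[n+1]C[k+1] m (suc k)) (nCk+nC[k+1]≡[n+1]C[k+1] m k) ⟨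
    (2 + k) * (b + c) + (1 + k) * (a + b)
      ≡⟨ regroup k a b c ⟩
    ((2 + k) * c + (1 + k) * b) + ((1 + k) * b + k * a) + (a + b)
      ≡⟨ cong₂ (λ x y → x + y + (a + b)) (binomial-absorption m (suc k)) (binomial-absorption m k) ⟩
    m * b + m * a + (a + b)
      ≡⟨ collect m a b ⟩
    (1 + m) * (a + b)
      ≡⟨ cong ((1 + m) *_) (nCk+nC[k+1]≡[n+1]C[k+1] m k) ⟩
    (1 + m) * (suc m C suc k) ∎
    where
    open ≡-Reasoning
    a = m C k
    b = m C suc k
    c = m C suc (suc k)
    regroup : ∀ k a b c → (2 + k) * (b + c) + (1 + k) * (a + b) ≡ ((2 + k) * c + (1 + k) * b) + ((1 + k) * b + k * a) + (a + b)
    regroup = solve-∀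
    collect : ∀ m a b → m * b + m * a + (a + b) ≡ (1 + m) * (a + b)
    collect = solve-∀

  squareBinomialSum-suc : ∀ k n → squareBinomialSum k (suc n) ≡ squareBinomialSum k n + n * (n * (n C k))
  squareBinomialSum-suc k n = ∑-toℕ-last n (λ m → m * (m * (m C k)))

open import Data.Nat using (ℕ; _≤_; _<_)
open import Data.Nat.Combinatorics using (_C_)
open import Data.Integer using (ℤ; +_; _+_; _-_; _*_)
open import Data.Fin using (Fin)
open import Data.Fin.Subset using (Subset)
open import Relation.Binary.PropositionalEquality using (_≡_)
open import Relation.Binary.PropositionalEquality using (refl; sym; trans; cong; cong₂; subst; module ≡-Reasoning)
open import Data.Nat using (zero; suc)
import Data.Nat as ℕ
import Data.Nat.Properties as ℕ
open import Data.Nat.Combinatorics using (nCk+nC[k+1]≡[n+1]C[k+1])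
open import Data.Integer.Properties using (pos-*; *-cancelˡ-≡; *-zeroʳ)
open import Data.Integer.Tactic.RingSolver using (solve-∀)
open Counting using (Dist; 3*Dist+n; squareBinomialSum; squareBinomialSum-suc; binomial-absorption; twiceWρk-identity)

-- Polynomial arithmetic over ℤ

eliminate : ∀ {a b} (c r : ℤ) → a ≡ b → r + c * (a - b) ≡ r
eliminate {a} c r refl = vanish r c a
  where
  vanish : ∀ r c a → r + c * (a - a) ≡ r
  vanish = solve-∀

-- From m² C(m,k) = k² C(m,k) + (k+1)(2k+1) C(m,k+1) + (k+1)(k+2) C(m,k+2), summed over m < n by the hockey-stick identity.
q : ℤ → ℤ → ℤ
q n k = k * k * (k + + 2) * (k + + 3) + (+ 1 + k) * (+ 2 * k + + 1) * (k + + 3) * (n - k - + 1)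
      + (+ 1 + k) * (k + + 2) * (n - k - + 1) * (n - k - + 2)

pathPolynomial : ℤ → ℤ → ℤ
pathPolynomial n k = + 5 * k * k * k * n * n + k * k * k * n
                   + + 18 * k * k * n * n - + 18 * k * k * n
                   - + 12 * k * k + + 19 * k * n * n - + 25 * k * n
                   + + 12 * k + + 6 * n * n - + 6 * n

-- The ring solver does not unfold definitions, so q and pathPolynomial are written out in the two identities below.
q-recurrence : ∀ m k → (m + + 1) * q (m + + 1) k ≡ (m - k) * q m k + (+ 1 + k) * ((k + + 2) * (k + + 3)) * (m * m)
q-recurrence = expanded
  where
  expanded : ∀ m k → let q = λ n → k * k * (k + + 2) * (k + + 3) + (+ 1 + k) * (+ 2 * k + + 1) * (k + + 3) * (n - k - + 1)
                                   + (+ 1 + k) * (k + + 2) * (n - k - + 1) * (n - k - + 2)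
                     in (m + + 1) * q (m + + 1) ≡ (m - k) * q m + (+ 1 + k) * ((k + + 2) * (k + + 3)) * (m * m)
  expanded = solve-∀

q-pathPolynomial : ∀ n k → let K = (+ 1 + k) * (k + + 2) * (k + + 3) in
  + 6 * K * (n * n * n - n * n) - K * (n * n * n - n) - + 12 * (n - k) * q n k ≡ (n + + 1) * pathPolynomial n k
q-pathPolynomial = expanded
  where
  expanded : ∀ n k → let K = (+ 1 + k) * (k + + 2) * (k + + 3)
                         q = k * k * (k + + 2) * (k + + 3) + (+ 1 + k) * (+ 2 * k + + 1) * (k + + 3) * (n - k - + 1)
                             + (+ 1 + k) * (k + + 2) * (n - k - + 1) * (n - k - + 2)
                         P = + 5 * k * k * k * n * n + k * k * k * n
                             + + 18 * k * k * n * n - + 18 * k * k * n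
                             - + 12 * k * k + + 19 * k * n * n - + 25 * k * n
                             + + 12 * k + + 6 * n * n - + 6 * n
                     in + 6 * K * (n * n * n - n * n) - K * (n * n * n - n) - + 12 * (n - k) * q ≡ (n + + 1) * P
  expanded = solve-∀

squareBinomialSum-suc-ℤ : ∀ k n → + squareBinomialSum k (suc n) ≡ + squareBinomialSum k n + + n * (+ n * + (n C k))
squareBinomialSum-suc-ℤ k n = trans (cong +_ (squareBinomialSum-suc k n))
  (cong (_+_ (+ squareBinomialSum k n)) (trans (pos-* n (n ℕ.* (n C k))) (cong (+ n *_) (pos-* n (n C k)))))

binomial-absorption-ℤ : ∀ m k → (+ 1 + + k) * + (m C suc k) + + k * + (m C k) ≡ + m * + (m C k)
binomial-absorption-ℤ m k = trans (sym (cong₂ _+_ (pos-* (suc k) (m C suc k)) (pos-* k (m C k))))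
                                  (trans (cong +_ (binomial-absorption m k)) (pos-* m (m C k)))

3*Dist+n-ℤ : ∀ n → + 3 * + Dist n + + n ≡ + n * + n * + n
3*Dist+n-ℤ n = trans (cong (_+ + n) (sym (pos-* 3 (Dist n))))
  (trans (cong +_ (3*Dist+n n)) (trans (pos-* (n ℕ.* n) n) (cong (_* + n) (pos-* n n))))

twiceWρk-identity-ℤ : ∀ n k (ρ : Subset n → Fin n → Fin n → ℕ) → (∀ A u v → IsRho (P n) A u v (ρ A u v)) →
  let c₀ = + (n C k); S = + squareBinomialSum k n in
  + twiceWρk n k ρ + c₀ * + Dist n + + 2 * (S + + n * (+ n * c₀) + S) ≡ c₀ * (+ n * (+ n * (+ 2 * + n)))
twiceWρk-identity-ℤ n k ρ isρ = begin
  T + c₀ * D + + 2 * (S + + n * (+ n * c₀) + S)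
    ≡⟨ cong₂ (λ x y → T + x + + 2 * (y + S)) (sym (pos-* (n C k) (Dist n))) (sym (squareBinomialSum-suc-ℤ k n)) ⟩
  T + + ((n C k) ℕ.* Dist n) + + 2 * + (S′ ℕ.+ squareBinomialSum k n)
    ≡⟨ cong (_+_ (T + + ((n C k) ℕ.* Dist n))) (sym (pos-* 2 (S′ ℕ.+ squareBinomialSum k n))) ⟩
  + (twiceWρk n k ρ ℕ.+ (n C k) ℕ.* Dist n ℕ.+ 2 ℕ.* (S′ ℕ.+ squareBinomialSum k n))
    ≡⟨ cong +_ (twiceWρk-identity n k ρ isρ) ⟩
  + ((n C k) ℕ.* (n ℕ.* (n ℕ.* (2 ℕ.* n))))
    ≡⟨ trans (pos-* (n C k) _)
             (cong (c₀ *_) (trans (pos-* n _) (cong (+ n *_) (trans (pos-* n _) (cong (+ n *_) (pos-* 2 n)))))) ⟩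
  c₀ * (+ n * (+ n * (+ 2 * + n))) ∎
  where
  open ≡-Reasoning
  T = + twiceWρk n k ρ
  D = + Dist n
  c₀ = + (n C k)
  S = + squareBinomialSum k n
  S′ = squareBinomialSum k (suc n)

square-sum-certificate : ∀ m k S c₀ c₁ Q₀ Q₁ →
  (+ 1 + k) * ((k + + 2) * (k + + 3) * (S + m * (m * c₀)))
    ≡ (+ 1 + k) * ((c₀ + c₁) * Q₁)
      + (+ 1 + k) * ((k + + 2) * (k + + 3) * S - c₁ * Q₀)
      + (Q₀ - Q₁) * ((+ 1 + k) * c₁ + k * c₀ - m * c₀)
      + c₀ * ((m - k) * Q₀ + (+ 1 + k) * ((k + + 2) * (k + + 3)) * (m * m) - (m + + 1) * Q₁)
square-sum-certificate = solve-∀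

squareBinomialSum-closed : ∀ k n → (+ k + + 2) * (+ k + + 3) * + squareBinomialSum k n ≡ + (n C suc k) * q (+ n) (+ k)
squareBinomialSum-closed k zero    = *-zeroʳ ((+ k + + 2) * (+ k + + 3))
squareBinomialSum-closed k (suc m) = *-cancelˡ-≡ (+ 1 + + k) _ _ (begin
  (+ 1 + + k) * (K * + squareBinomialSum k (suc m))
    ≡⟨ cong (λ s → (+ 1 + + k) * (K * s)) (squareBinomialSum-suc-ℤ k m) ⟩
  (+ 1 + + k) * (K * (S + + m * (+ m * c₀)))
    ≡⟨ square-sum-certificate (+ m) (+ k) S c₀ c₁ Q₀ Q₁ ⟩
  (+ 1 + + k) * ((c₀ + c₁) * Q₁)
    + (+ 1 + + k) * (K * S - c₁ * Q₀)
    + (Q₀ - Q₁) * ((+ 1 + + k) * c₁ + + k * c₀ - + m * c₀)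
    + c₀ * ((+ m - + k) * Q₀ + (+ 1 + + k) * K * (+ m * + m) - (+ m + + 1) * Q₁)
    ≡⟨ eliminate c₀ _ (sym recurrence) ⟩
  (+ 1 + + k) * ((c₀ + c₁) * Q₁)
    + (+ 1 + + k) * (K * S - c₁ * Q₀)
    + (Q₀ - Q₁) * ((+ 1 + + k) * c₁ + + k * c₀ - + m * c₀)
    ≡⟨ eliminate (Q₀ - Q₁) _ (binomial-absorption-ℤ m k) ⟩
  (+ 1 + + k) * ((c₀ + c₁) * Q₁) + (+ 1 + + k) * (K * S - c₁ * Q₀)
    ≡⟨ eliminate (+ 1 + + k) _ (squareBinomialSum-closed k m) ⟩
  (+ 1 + + k) * ((c₀ + c₁) * Q₁)
    ≡⟨ cong (λ c → (+ 1 + + k) * (+ c * Q₁)) (nCk+nC[k+1]≡[n+1]C[k+1] m k) ⟩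
  (+ 1 + + k) * (+ (suc m C suc k) * Q₁) ∎)
  where
  open ≡-Reasoning
  K = (+ k + + 2) * (+ k + + 3)
  S = + squareBinomialSum k m
  c₀ = + (m C k)
  c₁ = + (m C suc k)
  Q₀ = q (+ m) (+ k)
  Q₁ = q (+ suc m) (+ k)
  recurrence : (+ m + + 1) * Q₁ ≡ (+ m - + k) * Q₀ + (+ 1 + + k) * K * (+ m * + m)
  recurrence = subst (λ x → (+ m + + 1) * q x (+ k) ≡ (+ m - + k) * Q₀ + (+ 1 + + k) * K * (+ m * + m))
                     (cong +_ (ℕ.+-comm m 1)) (q-recurrence (+ m) (+ k))

-- 3(k+1) times the difference of the two sides of the goal of path-closed-form, written as a combination of the
-- differences of the sides of its hypotheses and of q-pathPolynomial.
closed-form-certificate : ∀ n k T D S c₀ c₁ Q P → let K = (+ 1 + k) * (k + + 2) * (k + + 3) in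
  + 3 * (+ 1 + k) * (+ 6 * (k + + 2) * (k + + 3) * T)
    ≡ + 3 * (+ 1 + k) * (+ 2 * (c₀ + c₁) * P)
      + + 18 * K * ((T + c₀ * D + + 2 * (S + n * (n * c₀) + S)) - c₀ * (n * (n * (+ 2 * n))))
      + + 6 * K * c₀ * (n * n * n - (+ 3 * D + n))
      + + 72 * (+ 1 + k) * (c₁ * Q - (k + + 2) * (k + + 3) * S)
      + (+ 72 * Q + + 6 * P) * (n * c₀ - ((+ 1 + k) * c₁ + k * c₀))
      + + 6 * c₀ * ((+ 6 * K * (n * n * n - n * n) - K * (n * n * n - n) - + 12 * (n - k) * Q) - (n + + 1) * P)
closed-form-certificate = solve-∀

path-closed-form : ∀ (n : ℤ) (k : ℕ) (T D S c₀ c₁ : ℤ) →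
  T + c₀ * D + + 2 * (S + n * (n * c₀) + S) ≡ c₀ * (n * (n * (+ 2 * n))) →
  + 3 * D + n ≡ n * n * n →
  (+ k + + 2) * (+ k + + 3) * S ≡ c₁ * q n (+ k) →
  (+ 1 + + k) * c₁ + + k * c₀ ≡ n * c₀ →
  + 6 * (+ k + + 2) * (+ k + + 3) * T ≡ + 2 * (c₀ + c₁) * pathPolynomial n (+ k)
path-closed-form n k T D S c₀ c₁ counting distances squares absorption =
  *-cancelˡ-≡ (+ 3 * (+ 1 + + k)) _ _
    (trans (closed-form-certificate n (+ k) T D S c₀ c₁ Q Poly)
    (trans (eliminate (+ 6 * c₀) _ (q-pathPolynomial n (+ k)))
    (trans (eliminate (+ 72 * Q + + 6 * Poly) _ (sym absorption))
    (trans (eliminate (+ 72 * (+ 1 + + k)) _ (sym squares))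
    (trans (eliminate (+ 6 * K * c₀) _ (sym distances))
           (eliminate (+ 18 * K) _ counting))))))
  where
  K = (+ 1 + + k) * (+ k + + 2) * (+ k + + 3)
  Q = q n (+ k)
  Poly = pathPolynomial n (+ k)

-- The identity holds for every n and k.
theorem5p12 : (n k : ℕ) → 2 < n → k ≤ n →
  (ρ : Subset n → Fin n → Fin n → ℕ) →
  (∀ A u v → IsRho (P n) A u v (ρ A u v)) →
  + 6 * (+ k + + 2) * (+ k + + 3) * + (twiceWρk n k ρ)
    ≡ + 2 * + ((Data.Nat._+_ n 1) C (Data.Nat._+_ k 1))
      * (+ 5 * + k * + k * + k * + n * + n + + k * + k * + k * + n
         + + 18 * + k * + k * + n * + n - + 18 * + k * + k * + n
         - + 12 * + k * + k + + 19 * + k * + n * + n - + 25 * + k * + n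
         + + 12 * + k + + 6 * + n * + n - + 6 * + n)
theorem5p12 n k _ _ ρ isρ = trans
  (path-closed-form (+ n) k (+ twiceWρk n k ρ) (+ Dist n) (+ squareBinomialSum k n) (+ (n C k)) (+ (n C suc k))
     (twiceWρk-identity-ℤ n k ρ isρ) (3*Dist+n-ℤ n) (squareBinomialSum-closed k n) (binomial-absorption-ℤ n k))
  (cong (λ c → + 2 * + c * pathPolynomial (+ n) (+ k))
        (trans (nCk+nC[k+1]≡[n+1]C[k+1] n k) (cong₂ _C_ (ℕ.+-comm 1 n) (ℕ.+-comm 1 k))))
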